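{- Let $\tau:\mathbb Q[B_n]\to\mathbb Q[S_n]$ be the linear extension of the map $B_n\to S_n$ forgetting signs. For every signed partition $(\lambda^+,\lambda^-)$ of $n$, $$\tau\big(\mathfrak g_{(\lambda^+,\lambda^-)}\big)=\begin{cases}\mathfrak e_{\lambda^+}&\text{if }\lambda^-=\emptyset,\\ 0&\text{otherwise.}\end{cases}$$
   Context: $B_n$: bijections $\sigma$ of $\{1,\bar1,\dots,n,\bar n\}$ with $\sigma(\bar i)=\overline{\sigma(i)}$; $S_n\le B_n$; $t_i$ swaps $i,\bar i$; $w_{0,J}=\prod_{i\in J}t_i$. A signed composition of $n$ is $p=(p_1,\dots,p_\ell)$ of nonzero integers with $\sum|p_i|=n$; $\zeta_i$ is the sign of $p_i$, $\hat p_i=|p_1|+\dots+|p_i|$ ($\hat p_0=0$), $\hat p=\{\hat p_1,\dots,\hat p_{\ell-1}\}$, $\Lambda(p_i)=\{\hat p_{i-1}+1,\dots,\hat p_i\}$; unsigned compositions are those with all $p_i>0$. A signed partition $(\lambda^+,\lambda^-)$ is a pair of partitions with $|\lambda^+|+|\lambda^-|=n$, $\ell(\lambda)=\ell(\lambda^+)+\ell(\lambda^-)$; $\overleftarrow p$ sorts the positive parts of $p$ decreasingly into $\lambda^+$ and the absolute values of negative parts decreasingly into $\lambda^-$. For $A\subseteq[n-1]$, $X_A=\sum_{w\in S_n,\ \mathrm{Des}(w)\subseteq A}w$ where $\mathrm{Des}(w)=\{i:w(i)>w(i+1)\}$. For an interval $J=\{a+1,\dots,a+m\}$, $S_J$ is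 the permutations fixing the complement of $J$, with descents $\{a+i:w(a+i)>w(a+i+1)\}$, $X^J_A$ the sum over $w\in S_J$ with descents in $A\subseteq\{a+1,\dots,a+m-1\}$, and $r_J=\sum_{A}\frac{(-1)^{|A|}}{|A|+1}X^J_A$. $\epsilon^\pm_J=\frac12(1\pm w_{0,J})$. $I_p=X_{\hat p}\epsilon^{\zeta_1}_{\Lambda(p_1)}r_{\Lambda(p_1)}\cdots\epsilon^{\zeta_\ell}_{\Lambda(p_\ell)}r_{\Lambda(p_\ell)}$, and $\mathfrak g_{(\lambda^+,\lambda^-)}=\frac1{\ell(\lambda)!}\sum_{p:\overleftarrow p=(\lambda^+,\lambda^-)}I_p$. For a partition $\lambda$ of $n$, the Garsia–Reutenauer idempotent is $\mathfrak e_\lambda=\frac1{\ell(\lambda)!}\sum_{p\text{ unsigned},\ \overleftarrow p=\lambda}X_{\hat p}\,r_{\Lambda(p_1)}\cdots r_{\Lambda(p_\ell)}\in\mathbb Q[S_n]$. -}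

module Defs where

open import Function using (_∘_; id)
open import Data.Bool using (Bool; true; false; not; _∧_; _∨_; _xor_; if_then_else_)
open import Data.Nat as ℕ using (ℕ; zero; suc; _+_; _∸_; _<ᵇ_; _≡ᵇ_; _≤ᵇ_; _!; _<_; _≥_)
open import Data.Integer as ℤ using (ℤ; +_; -[1+_]; ∣_∣)
open import Data.Rational as ℚ using (ℚ; 0ℚ; 1ℚ; ½)
open import Data.Fin as Fin using (Fin; toℕ)
open import Data.Fin.Properties using () renaming (_≟_ to _≟F_)
open import Data.Vec as Vec using (Vec; []; _∷_; lookup; tabulate)
open import Data.List as List using (List; []; _∷_; [_]; map; concatMap; filterᵇ; foldr; length; upTo; _++_)
open import Data.Bool.ListAction using (all; any)
open import Data.Nat.ListAction using (sum)
open import Data.List.Relation.Unary.All using (All)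
open import Data.List.Relation.Unary.Linked using (Linked)
open import Data.Product using (_×_; _,_; proj₁; proj₂)
import Data.Product.Properties as ×P
import Data.Vec.Properties as VecP
import Data.List.Properties as ListP
import Data.Bool.Properties as BoolP
open import Relation.Binary.PropositionalEquality using (_≡_)
open import Relation.Binary.Definitions using (DecidableEquality)
open import Relation.Nullary using (does)

-- Group algebra Q[G] of a finite group G, with elements represented as
-- finite formal linear combinations (lists of (coefficient , element)).

module GroupAlgebra {G : Set} (_≟G_ : DecidableEquality G)
                    (_∙_ : G → G → G) (e : G) where

  Alg : Set
  Alg = List (ℚ × G)

  𝟘 : Alg
  𝟘 = []

  𝟙 : Alg
  𝟙 = [ (1ℚ , e) ]

  infixl 6 _⊕_
  _⊕_ : Alg → Alg → Alg
  _⊕_ = _++_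

  infixr 7 _⊛_
  _⊛_ : ℚ → Alg → Alg
  c ⊛ x = map (λ { (a , g) → (c ℚ.* a , g) }) x

  infixl 7 _⊗_
  _⊗_ : Alg → Alg → Alg
  x ⊗ y = concatMap (λ { (a , g) → map (λ { (b , h) → (a ℚ.* b , g ∙ h) }) y }) x

  ∑ : List Alg → Alg
  ∑ = foldr _⊕_ 𝟘

  ∏ : List Alg → Alg
  ∏ = foldr _⊗_ 𝟙

  coeff : Alg → G → ℚ
  coeff x g = foldr ℚ._+_ 0ℚ (map proj₁ (filterᵇ (λ { (a , h) → does (h ≟G g) }) x))

  infix 4 _≈_
  _≈_ : Alg → Alg → Set
  x ≈ y = ∀ g → coeff x g ≡ coeff y g

-- S_n : permutations of {1..n}, stored as Vec (Fin n) n (0-based values);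
-- product is composition (σ π)(i) = σ(π(i)).
-- B_n : signed permutations, σ(i) = (j , b) meaning σ(i) = j if b = false
-- and σ(i) = j̄ if b = true; then σ(ī) = overline(σ(i)) is forced.

SPerm : ℕ → Set
SPerm n = Vec (Fin n) n

BPerm : ℕ → Set
BPerm n = Vec (Fin n × Bool) n

_∘S_ : ∀ {n} → SPerm n → SPerm n → SPerm n
σ ∘S π = tabulate (λ i → lookup σ (lookup π i))

_∘B_ : ∀ {n} → BPerm n → BPerm n → BPerm n
σ ∘B π = tabulate (λ i → let j = proj₁ (lookup π i)
                             s = proj₂ (lookup π i)
                         in (proj₁ (lookup σ j) , s xor proj₂ (lookup σ j)))

idS : ∀ {n} → SPerm n
idS {n} = Vec.allFin n

idB : ∀ {n} → BPerm n
idB {n} = tabulate (λ i → (i , false))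

_≟S_ : ∀ {n} → DecidableEquality (SPerm n)
_≟S_ = VecP.≡-dec _≟F_

_≟B_ : ∀ {n} → DecidableEquality (BPerm n)
_≟B_ = VecP.≡-dec (×P.≡-dec _≟F_ BoolP._≟_)

module QS (n : ℕ) = GroupAlgebra {SPerm n} _≟S_ _∘S_ idS
module QB (n : ℕ) = GroupAlgebra {BPerm n} _≟B_ _∘B_ idB

τ : ∀ {n} → QB.Alg n → QS.Alg n
τ = map (λ { (c , σ) → (c , Vec.map proj₁ σ) })

ι : ∀ {n} → QS.Alg n → QB.Alg n
ι = map (λ { (c , w) → (c , Vec.map (λ j → (j , false)) w) })

vecsOver : ∀ {A : Set} → List A → (k : ℕ) → List (Vec A k)
vecsOver xs zero = [ [] ]
vecsOver xs (suc k) = concatMap (λ x → map (x ∷_) (vecsOver xs k)) xs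

isPerm : ∀ {n} → Vec (Fin n) n → Bool
isPerm {n} v = all (λ j → any (λ x → does (x ≟F j)) (Vec.toList v)) (List.allFin n)

perms : (n : ℕ) → List (SPerm n)
perms n = filterᵇ isPerm (vecsOver (List.allFin n) n)

nth : List ℕ → ℕ → ℕ
nth [] _ = 0
nth (x ∷ xs) zero = x
nth (x ∷ xs) (suc i) = nth xs i

-- w(i) for 1 ≤ i ≤ n, as a number in {1..n}
val : ∀ {n} → SPerm n → ℕ → ℕ
val w i = nth (map (suc ∘ toℕ) (Vec.toList w)) (i ∸ 1)

interval : ℕ → ℕ → List ℕ
interval a m = map (λ k → a + suc k) (upTo m)

mem : ℕ → List ℕ → Bool
mem i A = any (i ≡ᵇ_) A

subsets : List ℕ → List (List ℕ)
subsets [] = [ [] ]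
subsets (x ∷ xs) = subsets xs ++ map (x ∷_) (subsets xs)

descentsIn : ∀ {n} → SPerm n → List ℕ → List ℕ → Bool
descentsIn w P A = all (λ i → not (val w (suc i) <ᵇ val w i) ∨ mem i A) P

X : (n : ℕ) → List ℕ → QS.Alg n
X n A = map (λ w → (1ℚ , w)) (filterᵇ (λ w → descentsIn w (interval 0 (n ∸ 1)) A) (perms n))

-- J = {a+1,…,a+m}; w ∈ S_J iff w fixes every i ∉ J
fixesOutside : ∀ {n} → SPerm n → ℕ → ℕ → Bool
fixesOutside {n} w a m = all (λ i → mem i (interval a m) ∨ (val w i ≡ᵇ i)) (interval 0 n)

XJ : (n a m : ℕ) → List ℕ → QS.Alg n
XJ n a m A = map (λ w → (1ℚ , w))
  (filterᵇ (λ w → fixesOutside w a m ∧ descentsIn w (interval a (m ∸ 1)) A) (perms n))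

negOnePow : ℕ → ℚ
negOnePow zero = 1ℚ
negOnePow (suc k) = ℚ.- negOnePow k

r : (n a m : ℕ) → QS.Alg n
r n a m = QS.∑ n (map (λ A → QS._⊛_ n (negOnePow (length A) ℚ.* (+ 1 ℚ./ suc (length A))) (XJ n a m A))
                      (subsets (interval a (m ∸ 1))))

w0 : (n a m : ℕ) → BPerm n
w0 n a m = tabulate (λ i → (i , mem (suc (toℕ i)) (interval a m)))

-- ε^ζ_J = ½ (1 ± w_{0,J}); ζ = true means +, false means -
ε : (ζ : Bool) → (n a m : ℕ) → QB.Alg n
ε ζ n a m = QB._⊛_ n ½ (QB._⊕_ n (QB.𝟙 n)
              (QB._⊛_ n (if ζ then 1ℚ else ℚ.- 1ℚ) [ (1ℚ , w0 n a m) ]))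

-- Signed compositions, represented as lists of nonzero integers

isPos : ℤ → Bool
isPos (+ suc _) = true
isPos _ = false

isNeg : ℤ → Bool
isNeg -[1+ _ ] = true
isNeg _ = false

nonzeroUpTo : ℕ → List ℤ
nonzeroUpTo n = map (λ k → + suc k) (upTo n) ++ map -[1+_] (upTo n)

signedComps : (n : ℕ) → List (List ℤ)
signedComps n = filterᵇ (λ p → sum (map ∣_∣ p) ≡ᵇ n)
  (concatMap (λ k → map Vec.toList (vecsOver (nonzeroUpTo n) k)) (upTo (suc n)))

-- blocks: (ζ_i , p̂_{i-1} , |p_i|), so that Λ(p_i) = interval p̂_{i-1} |p_i|
blocks : ℕ → List ℤ → List (Bool × ℕ × ℕ)
blocks a [] = []
blocks a (z ∷ zs) = (isPos z , a , ∣ z ∣) ∷ blocks (a + ∣ z ∣) zs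

partialSums : ℕ → List ℤ → List ℕ
partialSums a [] = []
partialSums a (z ∷ zs) = (a + ∣ z ∣) ∷ partialSums (a + ∣ z ∣) zs

dropLast : List ℕ → List ℕ
dropLast [] = []
dropLast (x ∷ []) = []
dropLast (x ∷ y ∷ ys) = x ∷ dropLast (y ∷ ys)

hat : List ℤ → List ℕ
hat p = dropLast (partialSums 0 p)

insertDesc : ℕ → List ℕ → List ℕ
insertDesc x [] = [ x ]
insertDesc x (y ∷ ys) = if y ≤ᵇ x then x ∷ y ∷ ys else y ∷ insertDesc x ys

sortDesc : List ℕ → List ℕ
sortDesc = foldr insertDesc []

arrow : List ℤ → List ℕ × List ℕ
arrow p = sortDesc (map ∣_∣ (filterᵇ isPos p)) , sortDesc (map ∣_∣ (filterᵇ isNeg p))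

_≟L_ : DecidableEquality (List ℕ)
_≟L_ = ListP.≡-dec ℕ._≟_

sortsTo : List ℤ → List ℕ → List ℕ → Bool
sortsTo p l⁺ l⁻ = does (proj₁ (arrow p) ≟L l⁺) ∧ does (proj₂ (arrow p) ≟L l⁻)

inv : ℕ → ℚ
inv zero = 0ℚ
inv (suc k) = + 1 ℚ./ suc k

I : (n : ℕ) → List ℤ → QB.Alg n
I n p = QB._⊗_ n (ι (X n (hat p)))
          (QB.∏ n (map (λ { (ζ , a , m) → QB._⊗_ n (ε ζ n a m) (ι (r n a m)) }) (blocks 0 p)))

𝔤 : (n : ℕ) → List ℕ → List ℕ → QB.Alg n
𝔤 n l⁺ l⁻ = QB._⊛_ n (inv ((length l⁺ + length l⁻) !))
  (QB.∑ n (map (I n) (filterᵇ (λ p → sortsTo p l⁺ l⁻) (signedComps n))))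

𝔢 : (n : ℕ) → List ℕ → QS.Alg n
𝔢 n l = QS._⊛_ n (inv (length l !))
  (QS.∑ n (map (λ p → QS._⊗_ n (X n (hat p))
                        (QS.∏ n (map (λ { (_ , a , m) → r n a m }) (blocks 0 p))))
              (filterᵇ (λ p → all isPos p ∧ sortsTo p l []) (signedComps n))))

IsPartition : List ℕ → Set
IsPartition l = All (0 <_) l × Linked _≥_ l

-- Forgetting signs is an algebra map sending w_{0,J} to the identity, so it sends
-- ε⁺_J to 1 and ε⁻_J to 0. Hence τ(I_p) = X_{p̂} r_{Λ(p₁)} ⋯ r_{Λ(p_ℓ)} when every part
-- of p is positive and τ(I_p) = 0 otherwise. Summing over the signed compositions
-- sorting to (λ⁺, λ⁻), only unsigned ones survive; they exist only when λ⁻ = ∅, and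
-- then they are exactly the compositions occurring in 𝔢_{λ⁺}.
module Submission where

open import Defs
open import Data.Nat using (ℕ; _+_)
open import Data.List using (List; [])
open import Data.Nat.ListAction using (sum)
open import Data.Product using (_×_)
open import Relation.Binary.PropositionalEquality using (_≡_; _≢_)

open import Algebra.Bundles using (CommutativeMonoid)
open import Algebra.Definitions using (Associative; LeftIdentity)
import Algebra.Properties.CommutativeSemigroup as CommutativeSemigroupProperties
open import Data.Bool using (Bool; true; false; _∧_; T; if_then_else_)
open import Data.Bool.ListAction using (all)
import Data.Bool.Properties as BoolP
import Data.Nat as ℕ
import Data.Nat.Properties as ℕP
open import Data.Integer using (ℤ; +_)
open import Data.Rational as ℚ using (ℚ; 0ℚ; 1ℚ; ½)
import Data.Rational.Properties as ℚP
open import Data.Vec as Vec using (lookup)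
import Data.Vec.Properties as VecP
open import Data.List using (_∷_; [_]; _++_; map; filterᵇ; foldr; length)
import Data.List.Properties as ListP
import Data.List.Relation.Unary.All as All
open import Data.Product using (_,_; proj₁; proj₂)
open import Function using (_∘_)
open import Relation.Binary.Definitions using (DecidableEquality)
open import Relation.Binary.PropositionalEquality
  using (refl; sym; trans; cong; cong₂; subst; subst₂; module ≡-Reasoning)
open import Relation.Nullary using (does)
open import Relation.Nullary.Decidable using (T?)

open CommutativeSemigroupProperties
  (CommutativeMonoid.commutativeSemigroup ℚP.+-0-commutativeMonoid)
  using () renaming (interchange to +-interchange)
open CommutativeSemigroupProperties
  (CommutativeMonoid.commutativeSemigroup ℚP.*-1-commutativeMonoid)
  using () renaming (x∙yz≈y∙xz to *-left-comm)

indicator : Bool → ℚ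
indicator true = 1ℚ
indicator false = 0ℚ

indicator-∧ : ∀ a b → indicator (a ∧ b) ≡ indicator a ℚ.* indicator b
indicator-∧ true b = sym (ℚP.*-identityˡ (indicator b))
indicator-∧ false b = sym (ℚP.*-zeroˡ (indicator b))

indicator-all : ∀ {A : Set} (P : A → Bool) xs →
                foldr ℚ._*_ 1ℚ (map (indicator ∘ P) xs) ≡ indicator (all P xs)
indicator-all P [] = refl
indicator-all P (x ∷ xs) =
  trans (cong (indicator (P x) ℚ.*_) (indicator-all P xs)) (sym (indicator-∧ (P x) (all P xs)))

module GroupAlgebraProperties {G : Set} (_≟G_ : DecidableEquality G)
                              (_∙_ : G → G → G) (e : G) where
  open GroupAlgebra _≟G_ _∙_ e

  -- With this, ((a , g) ∷ x) ⊗ y reduces to scale a g y ++ x ⊗ y.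
  scale : ℚ → G → Alg → Alg
  scale a g = map (λ (b , h) → (a ℚ.* b , g ∙ h))

  ⊗-distribʳ-++ : ∀ x y z → (x ++ y) ⊗ z ≡ x ⊗ z ++ y ⊗ z
  ⊗-distribʳ-++ x y z = ListP.concatMap-++ _ x y

  ⊛-distrib-++ : ∀ c x y → c ⊛ (x ++ y) ≡ c ⊛ x ++ c ⊛ y
  ⊛-distrib-++ c = ListP.map-++ _

  scale-⊛ : ∀ a g c z → scale a g (c ⊛ z) ≡ c ⊛ scale a g z
  scale-⊛ a g c [] = refl
  scale-⊛ a g c ((b , h) ∷ z) = cong₂ _∷_ (cong (_, g ∙ h) (*-left-comm a c b)) (scale-⊛ a g c z)

  ⊗-⊛ʳ : ∀ c x z → x ⊗ (c ⊛ z) ≡ c ⊛ (x ⊗ z)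
  ⊗-⊛ʳ c [] z = refl
  ⊗-⊛ʳ c ((a , g) ∷ x) z = begin
    scale a g (c ⊛ z) ++ x ⊗ (c ⊛ z) ≡⟨ cong₂ _++_ (scale-⊛ a g c z) (⊗-⊛ʳ c x z) ⟩
    c ⊛ scale a g z ++ c ⊛ (x ⊗ z)   ≡⟨ ⊛-distrib-++ c (scale a g z) (x ⊗ z) ⟨
    c ⊛ (scale a g z ++ x ⊗ z)       ∎
    where open ≡-Reasoning

  coeff-++ : ∀ x y g → coeff (x ++ y) g ≡ coeff x g ℚ.+ coeff y g
  coeff-++ [] y g = sym (ℚP.+-identityˡ _)
  coeff-++ ((a , h) ∷ x) y g with does (h ≟G g)
  ... | true = trans (cong (a ℚ.+_) (coeff-++ x y g)) (sym (ℚP.+-assoc a _ _))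
  ... | false = coeff-++ x y g

  coeff-⊛ : ∀ c x g → coeff (c ⊛ x) g ≡ c ℚ.* coeff x g
  coeff-⊛ c [] g = sym (ℚP.*-zeroʳ c)
  coeff-⊛ c ((a , h) ∷ x) g with does (h ≟G g)
  ... | true = trans (cong (c ℚ.* a ℚ.+_) (coeff-⊛ c x g)) (sym (ℚP.*-distribˡ-+ c a _))
  ... | false = coeff-⊛ c x g

  -- Left distributivity holds only coefficientwise: the terms come out in another order.
  coeff-⊗-distribˡ-++ : ∀ x y z g →
                        coeff (x ⊗ (y ++ z)) g ≡ coeff (x ⊗ y) g ℚ.+ coeff (x ⊗ z) g
  coeff-⊗-distribˡ-++ [] y z g = sym (ℚP.+-identityˡ 0ℚ)
  coeff-⊗-distribˡ-++ ((a , h) ∷ x) y z g = begin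
    C (scale a h (y ++ z) ++ x ⊗ (y ++ z))
      ≡⟨ coeff-++ (scale a h (y ++ z)) _ g ⟩
    C (scale a h (y ++ z)) ℚ.+ C (x ⊗ (y ++ z))
      ≡⟨ cong₂ ℚ._+_ (trans (cong C (ListP.map-++ _ y z)) (coeff-++ (scale a h y) _ g))
                     (coeff-⊗-distribˡ-++ x y z g) ⟩
    (C (scale a h y) ℚ.+ C (scale a h z)) ℚ.+ (C (x ⊗ y) ℚ.+ C (x ⊗ z))
      ≡⟨ +-interchange (C (scale a h y)) (C (scale a h z)) (C (x ⊗ y)) (C (x ⊗ z)) ⟩
    (C (scale a h y) ℚ.+ C (x ⊗ y)) ℚ.+ (C (scale a h z) ℚ.+ C (x ⊗ z))
      ≡⟨ cong₂ ℚ._+_ (coeff-++ (scale a h y) _ g) (coeff-++ (scale a h z) _ g) ⟨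
    C (scale a h y ++ x ⊗ y) ℚ.+ C (scale a h z ++ x ⊗ z) ∎
    where
    open ≡-Reasoning
    C : Alg → ℚ
    C w = coeff w g

  coeff-∑-filter : ∀ {A : Set} (P f : A → Bool) (u v : A → Alg) g →
                   (∀ p → coeff (u p) g ≡ indicator (P p) ℚ.* coeff (v p) g) → ∀ ps →
                   coeff (∑ (map u (filterᵇ f ps))) g
                     ≡ coeff (∑ (map v (filterᵇ (λ p → P p ∧ f p) ps))) g
  coeff-∑-filter P f u v g hyp [] = refl
  coeff-∑-filter P f u v g hyp (p ∷ ps) with f p | P p | hyp p
  ... | false | true  | _ = coeff-∑-filter P f u v g hyp ps
  ... | false | false | _ = coeff-∑-filter P f u v g hyp ps
  ... | true  | true  | hp =
    trans (coeff-++ (u p) _ g)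
      (trans (cong₂ ℚ._+_ (trans hp (ℚP.*-identityˡ (coeff (v p) g))) rest)
             (sym (coeff-++ (v p) (∑ (map v (filterᵇ (λ p → P p ∧ f p) ps))) g)))
    where rest = coeff-∑-filter P f u v g hyp ps
  ... | true  | false | hp =
    trans (coeff-++ (u p) _ g)
      (trans (cong₂ ℚ._+_ (trans hp (ℚP.*-zeroˡ (coeff (v p) g))) rest)
             (ℚP.+-identityˡ (coeff (∑ (map v (filterᵇ (λ p → P p ∧ f p) ps))) g)))
    where rest = coeff-∑-filter P f u v g hyp ps

  -- Quantifying over a left factor z lets the property pass through products
  -- without ever proving that ⊗ respects ≈.
  ActsAsScalar : ℚ → Alg → Set
  ActsAsScalar c s = ∀ z y g → coeff (z ⊗ (s ⊗ y)) g ≡ c ℚ.* coeff (z ⊗ y) g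

  actsAsScalar-++ : ∀ {a b s t} → ActsAsScalar a s → ActsAsScalar b t →
                    ActsAsScalar (a ℚ.+ b) (s ++ t)
  actsAsScalar-++ {a} {b} {s} {t} hs ht z y g = begin
    coeff (z ⊗ ((s ++ t) ⊗ y)) g
      ≡⟨ cong (λ w → coeff (z ⊗ w) g) (⊗-distribʳ-++ s t y) ⟩
    coeff (z ⊗ (s ⊗ y ++ t ⊗ y)) g
      ≡⟨ coeff-⊗-distribˡ-++ z (s ⊗ y) (t ⊗ y) g ⟩
    coeff (z ⊗ (s ⊗ y)) g ℚ.+ coeff (z ⊗ (t ⊗ y)) g
      ≡⟨ cong₂ ℚ._+_ (hs z y g) (ht z y g) ⟩
    a ℚ.* coeff (z ⊗ y) g ℚ.+ b ℚ.* coeff (z ⊗ y) g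
      ≡⟨ ℚP.*-distribʳ-+ _ a b ⟨
    (a ℚ.+ b) ℚ.* coeff (z ⊗ y) g
      ∎
    where open ≡-Reasoning

  module WithMonoidLaws (∙-assoc : Associative _≡_ _∙_)
                        (∙-identityˡ : LeftIdentity _≡_ e _∙_) where

    scale-scale : ∀ a g b h z → scale a g (scale b h z) ≡ scale (a ℚ.* b) (g ∙ h) z
    scale-scale a g b h [] = refl
    scale-scale a g b h ((c , k) ∷ z) =
      cong₂ _∷_ (cong₂ _,_ (sym (ℚP.*-assoc a b c)) (sym (∙-assoc g h k))) (scale-scale a g b h z)

    scale-⊗ : ∀ a g y z → scale a g (y ⊗ z) ≡ scale a g y ⊗ z
    scale-⊗ a g [] z = refl
    scale-⊗ a g ((b , h) ∷ y) z = begin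
      scale a g (scale b h z ++ y ⊗ z)
        ≡⟨ ListP.map-++ _ (scale b h z) (y ⊗ z) ⟩
      scale a g (scale b h z) ++ scale a g (y ⊗ z)
        ≡⟨ cong₂ _++_ (scale-scale a g b h z) (scale-⊗ a g y z) ⟩
      scale (a ℚ.* b) (g ∙ h) z ++ scale a g y ⊗ z ∎
      where open ≡-Reasoning

    ⊗-assoc : ∀ x y z → (x ⊗ y) ⊗ z ≡ x ⊗ (y ⊗ z)
    ⊗-assoc [] y z = refl
    ⊗-assoc ((a , g) ∷ x) y z = begin
      (scale a g y ++ x ⊗ y) ⊗ z      ≡⟨ ⊗-distribʳ-++ (scale a g y) (x ⊗ y) z ⟩
      scale a g y ⊗ z ++ (x ⊗ y) ⊗ z  ≡⟨ cong₂ _++_ (sym (scale-⊗ a g y z)) (⊗-assoc x y z) ⟩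
      scale a g (y ⊗ z) ++ x ⊗ (y ⊗ z) ∎
      where open ≡-Reasoning

    scale-identity : ∀ a y → scale a e y ≡ a ⊛ y
    scale-identity a [] = refl
    scale-identity a ((b , h) ∷ y) = cong₂ _∷_ (cong (_ ,_) (∙-identityˡ h)) (scale-identity a y)

    scalar-actsAsScalar : ∀ a → ActsAsScalar a [ (a , e) ]
    scalar-actsAsScalar a z y g = begin
      coeff (z ⊗ (scale a e y ++ [])) g
        ≡⟨ cong (λ w → coeff (z ⊗ w) g) (trans (ListP.++-identityʳ _) (scale-identity a y)) ⟩
      coeff (z ⊗ (a ⊛ y)) g  ≡⟨ cong (λ w → coeff w g) (⊗-⊛ʳ a z y) ⟩
      coeff (a ⊛ (z ⊗ y)) g  ≡⟨ coeff-⊛ a (z ⊗ y) g ⟩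
      a ℚ.* coeff (z ⊗ y) g  ∎
      where open ≡-Reasoning

    coeff-⊗-∏-scalars : ∀ {B : Set} (s t : B → Alg) (c : B → ℚ) →
                        (∀ b → ActsAsScalar (c b) (s b)) → ∀ bs z g →
                        coeff (z ⊗ ∏ (map (λ b → s b ⊗ t b) bs)) g
                          ≡ foldr ℚ._*_ 1ℚ (map c bs) ℚ.* coeff (z ⊗ ∏ (map t bs)) g
    coeff-⊗-∏-scalars s t c hs [] z g = sym (ℚP.*-identityˡ _)
    coeff-⊗-∏-scalars s t c hs (b ∷ bs) z g = begin
      C (z ⊗ ((s b ⊗ t b) ⊗ S))         ≡⟨ cong (λ w → C (z ⊗ w)) (⊗-assoc (s b) (t b) S) ⟩
      C (z ⊗ (s b ⊗ (t b ⊗ S)))         ≡⟨ hs b z (t b ⊗ S) g ⟩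
      c b ℚ.* C (z ⊗ (t b ⊗ S))         ≡⟨ cong (λ w → c b ℚ.* C w) (⊗-assoc z (t b) S) ⟨
      c b ℚ.* C ((z ⊗ t b) ⊗ S)         ≡⟨ cong (c b ℚ.*_) (coeff-⊗-∏-scalars s t c hs bs (z ⊗ t b) g) ⟩
      c b ℚ.* (Π ℚ.* C ((z ⊗ t b) ⊗ R)) ≡⟨ cong (λ w → c b ℚ.* (Π ℚ.* C w)) (⊗-assoc z (t b) R) ⟩
      c b ℚ.* (Π ℚ.* C (z ⊗ (t b ⊗ R))) ≡⟨ ℚP.*-assoc (c b) Π _ ⟨
      (c b ℚ.* Π) ℚ.* C (z ⊗ (t b ⊗ R)) ∎
      where
      open ≡-Reasoning
      C : Alg → ℚ
      C w = coeff w g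
      S = ∏ (map (λ b → s b ⊗ t b) bs)
      R = ∏ (map t bs)
      Π = foldr ℚ._*_ 1ℚ (map c bs)

module Pushforward {G H : Set}
  (_≟G_ : DecidableEquality G) (_∙G_ : G → G → G) (eG : G)
  (_≟H_ : DecidableEquality H) (_∙H_ : H → H → H) (eH : H)
  (φ : G → H) (φ-∙ : ∀ g h → φ (g ∙G h) ≡ φ g ∙H φ h) (φ-e : φ eG ≡ eH) where

  private
    module A = GroupAlgebra _≟G_ _∙G_ eG
    module B = GroupAlgebra _≟H_ _∙H_ eH
    module PA = GroupAlgebraProperties _≟G_ _∙G_ eG
    module PB = GroupAlgebraProperties _≟H_ _∙H_ eH

  push : A.Alg → B.Alg
  push = map (λ (c , g) → (c , φ g))

  push-⊛ : ∀ c x → push (c A.⊛ x) ≡ c B.⊛ push x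
  push-⊛ c [] = refl
  push-⊛ c (_ ∷ x) = cong (_ ∷_) (push-⊛ c x)

  push-scale : ∀ a g y → push (PA.scale a g y) ≡ PB.scale a (φ g) (push y)
  push-scale a g [] = refl
  push-scale a g ((b , h) ∷ y) = cong₂ _∷_ (cong (_ ,_) (φ-∙ g h)) (push-scale a g y)

  push-⊗ : ∀ x y → push (x A.⊗ y) ≡ push x B.⊗ push y
  push-⊗ [] y = refl
  push-⊗ ((a , g) ∷ x) y =
    trans (ListP.map-++ _ (PA.scale a g y) (x A.⊗ y))
          (cong₂ _++_ (push-scale a g y) (push-⊗ x y))

  push-∑ : ∀ xs → push (A.∑ xs) ≡ B.∑ (map push xs)
  push-∑ [] = refl
  push-∑ (x ∷ xs) = trans (ListP.map-++ _ x (A.∑ xs)) (cong (push x ++_) (push-∑ xs))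

  push-∏ : ∀ xs → push (A.∏ xs) ≡ B.∏ (map push xs)
  push-∏ [] = cong (λ h → [ (1ℚ , h) ]) φ-e
  push-∏ (x ∷ xs) = trans (push-⊗ x (A.∏ xs)) (cong (push x B.⊗_) (push-∏ xs))

∘S-assoc : ∀ {n} → Associative _≡_ (_∘S_ {n})
∘S-assoc a b c = VecP.tabulate-cong λ i →
  trans (VecP.lookup∘tabulate (λ j → lookup a (lookup b j)) (lookup c i))
        (sym (cong (lookup a) (VecP.lookup∘tabulate (λ j → lookup b (lookup c j)) i)))

idS-identityˡ : ∀ {n} → LeftIdentity _≡_ (idS {n}) _∘S_
idS-identityˡ a =
  trans (VecP.tabulate-cong (λ i → VecP.lookup-allFin (lookup a i))) (VecP.tabulate∘lookup a)

unsign : ∀ {n} → BPerm n → SPerm n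
unsign = Vec.map proj₁

unsign-∘ : ∀ {n} (σ π : BPerm n) → unsign (σ ∘B π) ≡ unsign σ ∘S unsign π
unsign-∘ σ π = trans (sym (VecP.tabulate-∘ proj₁ _)) (VecP.tabulate-cong λ i →
  sym (trans (VecP.lookup-map _ proj₁ σ)
             (cong (λ k → proj₁ (lookup σ k)) (VecP.lookup-map i proj₁ π))))

unsign-idB : ∀ {n} → unsign (idB {n}) ≡ idS
unsign-idB = sym (VecP.tabulate-∘ proj₁ _)

unsign-w0 : ∀ n a m → unsign (w0 n a m) ≡ idS
unsign-w0 n a m = sym (VecP.tabulate-∘ proj₁ _)

all-blocks : ∀ a p → all proj₁ (blocks a p) ≡ all isPos p
all-blocks a [] = refl
all-blocks a (z ∷ p) = cong (isPos z ∧_) (all-blocks _ p)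

negativeParts-positive : ∀ p → all isPos p ≡ true → filterᵇ isNeg p ≡ []
negativeParts-positive [] _ = refl
negativeParts-positive (+ ℕ.suc _ ∷ p) h = negativeParts-positive p h

positive-sortsTo-nonempty : ∀ p l⁺ l⁻ → l⁻ ≢ [] → all isPos p ∧ sortsTo p l⁺ l⁻ ≡ false
positive-sortsTo-nonempty p l⁺ [] l⁻≢[] with () ← l⁻≢[] refl
positive-sortsTo-nonempty p l⁺ (k ∷ l⁻) _ with all isPos p in positive
... | false = refl
... | true rewrite negativeParts-positive p positive = BoolP.∧-zeroʳ _

module SignForgetting (n : ℕ) where
  open QS n
  open GroupAlgebraProperties (_≟S_ {n}) _∘S_ idS
  open WithMonoidLaws ∘S-assoc idS-identityˡ
  open Pushforward (_≟B_ {n}) _∘B_ idB _≟S_ _∘S_ idS unsign unsign-∘ unsign-idB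
    renaming (push-⊛ to τ-⊛; push-⊗ to τ-⊗; push-∑ to τ-∑; push-∏ to τ-∏)

  τ-ι : ∀ (x : Alg) → τ (ι x) ≡ x
  τ-ι [] = refl
  τ-ι ((c , w) ∷ x) =
    cong₂ _∷_ (cong (c ,_) (trans (sym (VecP.map-∘ proj₁ _ w)) (VecP.map-id w))) (τ-ι x)

  τ-ε-actsAsScalar : ∀ ζ a m → ActsAsScalar (indicator ζ) (τ (ε ζ n a m))
  τ-ε-actsAsScalar ζ a m =
    subst₂ ActsAsScalar (halves ζ) (sym τ-ε) halfScalars
    where
    ½₊ ½ζ : ℚ
    ½₊ = ½ ℚ.* 1ℚ
    ½ζ = ½ ℚ.* ((if ζ then 1ℚ else ℚ.- 1ℚ) ℚ.* 1ℚ)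

    τ-ε : τ (ε ζ n a m) ≡ [ (½₊ , idS) ] ++ [ (½ζ , idS) ]
    τ-ε = cong₂ (λ g h → (½₊ , g) ∷ (½ζ , h) ∷ []) unsign-idB (unsign-w0 n a m)

    halfScalars : ActsAsScalar (½₊ ℚ.+ ½ζ) ([ (½₊ , idS) ] ++ [ (½ζ , idS) ])
    halfScalars = actsAsScalar-++ {½₊} {½ζ} {[ (½₊ , idS) ]} {[ (½ζ , idS) ]}
                    (scalar-actsAsScalar ½₊) (scalar-actsAsScalar ½ζ)

    halves : ∀ ζ → ½ ℚ.* 1ℚ ℚ.+ ½ ℚ.* ((if ζ then 1ℚ else ℚ.- 1ℚ) ℚ.* 1ℚ) ≡ indicator ζ
    halves true = refl
    halves false = refl

  private
    module B = QB n

  signedBlockFactor : Bool × ℕ × ℕ → B.Alg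
  signedBlockFactor (ζ , a , m) = ε ζ n a m B.⊗ ι (r n a m)

  signFactor blockFactor : Bool × ℕ × ℕ → Alg
  signFactor (ζ , a , m) = τ (ε ζ n a m)
  blockFactor (_ , a , m) = r n a m

  τ-I : ∀ p → τ (I n p)
              ≡ X n (hat p) ⊗ ∏ (map (λ b → signFactor b ⊗ blockFactor b) (blocks 0 p))
  τ-I p = begin
    τ (ι (X n (hat p)) B.⊗ B.∏ (map signedBlockFactor (blocks 0 p)))
      ≡⟨ τ-⊗ (ι (X n (hat p))) (B.∏ (map signedBlockFactor (blocks 0 p))) ⟩
    τ (ι (X n (hat p))) ⊗ τ (B.∏ (map signedBlockFactor (blocks 0 p)))
      ≡⟨ cong₂ _⊗_ (τ-ι (X n (hat p))) (τ-∏ (map signedBlockFactor (blocks 0 p))) ⟩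
    X n (hat p) ⊗ ∏ (map τ (map signedBlockFactor (blocks 0 p)))
      ≡⟨ cong (λ fs → X n (hat p) ⊗ ∏ fs)
              (trans (sym (ListP.map-∘ (blocks 0 p))) (ListP.map-cong τ-factor (blocks 0 p))) ⟩
    X n (hat p) ⊗ ∏ (map (λ b → signFactor b ⊗ blockFactor b) (blocks 0 p)) ∎
    where
    open ≡-Reasoning
    τ-factor : ∀ b → τ (signedBlockFactor b) ≡ signFactor b ⊗ blockFactor b
    τ-factor (ζ , a , m) =
      trans (τ-⊗ (ε ζ n a m) (ι (r n a m))) (cong (τ (ε ζ n a m) ⊗_) (τ-ι (r n a m)))

  unsignedTerm : List ℤ → Alg
  unsignedTerm p = X n (hat p) ⊗ ∏ (map blockFactor (blocks 0 p))

  coeff-τ-I : ∀ p g → coeff (τ (I n p)) g ≡ indicator (all isPos p) ℚ.* coeff (unsignedTerm p) g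
  coeff-τ-I p g = begin
    coeff (τ (I n p)) g
      ≡⟨ cong (λ w → coeff w g) (τ-I p) ⟩
    coeff (X n (hat p) ⊗ ∏ (map (λ b → signFactor b ⊗ blockFactor b) (blocks 0 p))) g
      ≡⟨ coeff-⊗-∏-scalars signFactor blockFactor (indicator ∘ proj₁)
           (λ (ζ , a , m) → τ-ε-actsAsScalar ζ a m) (blocks 0 p) (X n (hat p)) g ⟩
    foldr ℚ._*_ 1ℚ (map (indicator ∘ proj₁) (blocks 0 p)) ℚ.* coeff (unsignedTerm p) g
      ≡⟨ cong (ℚ._* coeff (unsignedTerm p) g)
              (trans (indicator-all proj₁ (blocks 0 p)) (cong indicator (all-blocks 0 p))) ⟩
    indicator (all isPos p) ℚ.* coeff (unsignedTerm p) g ∎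
    where open ≡-Reasoning

  unsignedComps : List ℕ → List ℕ → List (List ℤ)
  unsignedComps l⁺ l⁻ = filterᵇ (λ p → all isPos p ∧ sortsTo p l⁺ l⁻) (signedComps n)

  coeff-τ-𝔤 : ∀ l⁺ l⁻ g →
              coeff (τ (𝔤 n l⁺ l⁻)) g
                ≡ inv ((length l⁺ + length l⁻) ℕ.!)
                    ℚ.* coeff (∑ (map unsignedTerm (unsignedComps l⁺ l⁻))) g
  coeff-τ-𝔤 l⁺ l⁻ g = begin
    coeff (τ (c B.⊛ B.∑ (map (I n) comps))) g
      ≡⟨ cong (λ w → coeff w g) (τ-⊛ c (B.∑ (map (I n) comps))) ⟩
    coeff (c ⊛ τ (B.∑ (map (I n) comps))) g
      ≡⟨ coeff-⊛ c (τ (B.∑ (map (I n) comps))) g ⟩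
    c ℚ.* coeff (τ (B.∑ (map (I n) comps))) g
      ≡⟨ cong (λ w → c ℚ.* coeff w g)
              (trans (τ-∑ (map (I n) comps)) (cong ∑ (sym (ListP.map-∘ comps)))) ⟩
    c ℚ.* coeff (∑ (map (τ ∘ I n) comps)) g
      ≡⟨ cong (c ℚ.*_) (coeff-∑-filter (all isPos) (λ p → sortsTo p l⁺ l⁻) (τ ∘ I n) unsignedTerm g
                          (λ p → coeff-τ-I p g) (signedComps n)) ⟩
    c ℚ.* coeff (∑ (map unsignedTerm (unsignedComps l⁺ l⁻))) g ∎
    where
    open ≡-Reasoning
    c = inv ((length l⁺ + length l⁻) ℕ.!)
    comps = filterᵇ (λ p → sortsTo p l⁺ l⁻) (signedComps n)

  unsignedComps-nonempty : ∀ l⁺ l⁻ → l⁻ ≢ [] → unsignedComps l⁺ l⁻ ≡ []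
  unsignedComps-nonempty l⁺ l⁻ l⁻≢[] =
    ListP.filter-none (T? ∘ λ p → all isPos p ∧ sortsTo p l⁺ l⁻) {signedComps n}
      (All.tabulate λ {p} _ → subst T (positive-sortsTo-nonempty p l⁺ l⁻ l⁻≢[]))

proposition6p8 : (n : ℕ) (l⁺ l⁻ : List ℕ) → IsPartition l⁺ → IsPartition l⁻ →
    sum l⁺ + sum l⁻ ≡ n →
    (l⁻ ≡ [] → QS._≈_ n (τ (𝔤 n l⁺ l⁻)) (𝔢 n l⁺))
    × (l⁻ ≢ [] → QS._≈_ n (τ (𝔤 n l⁺ l⁻)) (QS.𝟘 n))
proposition6p8 n l⁺ l⁻ _ _ _ = unsigned , signed
  where
  open QS n using (coeff; ∑)
  open GroupAlgebraProperties (_≟S_ {n}) _∘S_ idS using (coeff-⊛)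
  open SignForgetting n
  open ≡-Reasoning

  unsigned : l⁻ ≡ [] → QS._≈_ n (τ (𝔤 n l⁺ l⁻)) (𝔢 n l⁺)
  unsigned refl g = begin
    coeff (τ (𝔤 n l⁺ [])) g
      ≡⟨ coeff-τ-𝔤 l⁺ [] g ⟩
    inv ((length l⁺ + 0) ℕ.!) ℚ.* coeff S g
      ≡⟨ cong (λ k → inv (k ℕ.!) ℚ.* coeff S g) (ℕP.+-identityʳ (length l⁺)) ⟩
    inv (length l⁺ ℕ.!) ℚ.* coeff S g
      ≡⟨ coeff-⊛ (inv (length l⁺ ℕ.!)) S g ⟨
    coeff (𝔢 n l⁺) g ∎
    where S = ∑ (map unsignedTerm (unsignedComps l⁺ []))

  signed : l⁻ ≢ [] → QS._≈_ n (τ (𝔤 n l⁺ l⁻)) (QS.𝟘 n)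
  signed l⁻≢[] g = begin
    coeff (τ (𝔤 n l⁺ l⁻)) g
      ≡⟨ coeff-τ-𝔤 l⁺ l⁻ g ⟩
    c ℚ.* coeff (∑ (map unsignedTerm (unsignedComps l⁺ l⁻))) g
      ≡⟨ cong (λ ps → c ℚ.* coeff (∑ (map unsignedTerm ps)) g)
              (unsignedComps-nonempty l⁺ l⁻ l⁻≢[]) ⟩
    c ℚ.* 0ℚ
      ≡⟨ ℚP.*-zeroʳ c ⟩
    0ℚ ∎
    where c = inv ((length l⁺ + length l⁻) ℕ.!)
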